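{- Let $\Gamma$, $F$, $\Sigma$, $\Sigma_0$, $I_F$, $\preceq$, $V_F$, $R$ and $\epsilon_F$ be as described in the context. Let $g\in\Gamma$ and $u\in I_F$, and suppose $\epsilon_F(u,g)$ holds. Then there is a unique $h\in\Gamma$ such that $R(h,u)$ holds and $u\prec V_F(g-h)$.
   Context: $\Gamma$ is an abelian group, $F:\Gamma\to\Gamma$ an injective endomorphism, and $\Gamma$ is finitely generated as a $\mathbb{Z}[F]$-module ($X$ acting as $F$). $\Sigma\subseteq\Gamma$ is finite, contains $0$, is symmetric, generates $\Gamma$ as a $\mathbb{Z}[F]$-module, and satisfies $\Sigma\cap F(\Gamma)=\{0\}$. For $\sigma=a_0\cdots a_n\in\Sigma^*$ put $[\sigma]_F=a_0+F(a_1)+\dots+F^n(a_n)$. $\Sigma$ is assumed $F$-spanning: (C1) every element of $\Gamma$ is $[\sigma]_F$ for some $\sigma\in\Sigma^*$; (C2) $a_1+a_2+a_3\in\Sigma+F(\Sigma)$ for all $a_1,a_2,a_3\in\Sigma$; (C3) if $a_1,a_2\in\Sigma$ and $a_1+a_2=F(b)$ with $b\in\Gamma$, then $b\in\Sigma$. $\Sigma_0\subseteq\Sigma$ contains $0$ and exactly one representative of each class modulo $F(\Gamma)$ meeting $\Sigma$. $I_F:=\{F^n(a): a\in\Sigma\setminus\{0\}, n\in\mathbb{N}\}$. Preorder on $I_F\cup\{0\}$: $F^i(a)\preceq F^j(b)$ iff $i\le j$ (for $a,b\in\Sigma\setminus\{0\}$), and $v\prec 0$ for every $v\in I_F$; $x\prec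 y$ means $x\preceq y$ and not $y\preceq x$. $V_F:\Gamma\to I_F\cup\{0\}$: $V_F(0)=0$, and for $g\neq 0$, writing $g=\sum_{i=m}^nF^i(b_i)$ with $b_m\in\Sigma_0\setminus\{0\}$ and $b_i\in\Sigma$ (such a representation exists), $V_F(g):=F^m(b_m)$. $R\subseteq\Gamma\times\Gamma$: $R(0,0)$ holds, and for $g\neq 0$, $R(g,u)$ holds iff $u=F^n(a)$ with $a\in\Sigma\setminus\{0\}$ and $g=\sum_{i=m}^nF^i(a_i)$ for some $a_i\in\Sigma$ with $a_m\neq0$ and $a_n=a$. $\epsilon_F(u,g)$ holds iff $u\in I_F$ and ($g=u$ or there is $h\in\Gamma$ with $R(h,u)$ and $u\prec V_F(g-h)$). -}

module Defs where

open import Level using (_⊔_)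
open import Data.Nat using (ℕ; zero; suc; _+_; _≤_)
open import Data.List using (List; []; _∷_; _++_; length)
open import Data.List.Relation.Unary.All using (All)
open import Data.List.Relation.Unary.Any using (Any)
open import Data.Product using (Σ; ∃; ∃-syntax; _×_; _,_)
open import Data.Sum using (_⊎_)
open import Data.Empty using (⊥)
open import Relation.Nullary using (¬_)
open import Algebra.Bundles using (AbelianGroup)
open import Algebra.Morphism.Structures using (module GroupMorphisms)

-- Everything is relative to an abelian group G (setoid equality _≈_,
-- operation _∙_ written additively in the paper, unit ε = 0, inverse _⁻¹),
-- a map F : Γ → Γ, and two finite lists Sig (= Σ) and Sig0 (= Σ₀).
module Theory {c ℓ} (G : AbelianGroup c ℓ) (F : AbelianGroup.Carrier G → AbelianGroup.Carrier G)
              (Sig Sig0 : List (AbelianGroup.Carrier G)) where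

  open AbelianGroup G

  Fpow : ℕ → Carrier → Carrier
  Fpow zero    x = x
  Fpow (suc n) x = F (Fpow n x)

  _∈L_ : Carrier → List Carrier → Set (c ⊔ ℓ)
  x ∈L xs = Any (x ≈_) xs

  _∈Σ_ : Carrier → List Carrier → Set (c ⊔ ℓ)
  _∈Σ_ = _∈L_

  -- [a₀ a₁ … aₙ]_F = a₀ + F(a₁) + … + Fⁿ(aₙ)   (empty word ↦ 0)
  evalF : List Carrier → Carrier
  evalF []       = ε
  evalF (a ∷ as) = a ∙ F (evalF as)

  InImF : Carrier → Set (c ⊔ ℓ)
  InImF x = ∃[ y ] x ≈ F y

  data Span (S : Carrier → Set (c ⊔ ℓ)) : Carrier → Set (c ⊔ ℓ) where
    gen  : ∀ {x} → S x → Span S x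
    zer  : Span S ε
    add  : ∀ {x y} → Span S x → Span S y → Span S (x ∙ y)
    neg  : ∀ {x} → Span S x → Span S (x ⁻¹)
    appF : ∀ {x} → Span S x → Span S (F x)
    resp : ∀ {x y} → x ≈ y → Span S x → Span S y

  FinGen : Set (c ⊔ ℓ)
  FinGen = ∃[ gs ] (∀ x → Span (_∈L gs) x)

  HeadNZ : List Carrier → Set ℓ
  HeadNZ []      = Level.Lift ℓ ⊥
  HeadNZ (x ∷ _) = ¬ x ≈ ε

  record Hyp : Set (c ⊔ ℓ) where
    field
      F-mono   : GroupMorphisms.IsGroupMonomorphism rawGroup rawGroup F
      fingen   : FinGen
      Σ-zero   : ε ∈Σ Sig
      Σ-sym    : ∀ {a} → a ∈Σ Sig → (a ⁻¹) ∈Σ Sig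
      Σ-gen    : ∀ x → Span (_∈Σ Sig) x
      Σ-∩F     : ∀ {a} → a ∈Σ Sig → InImF a → a ≈ ε
      C1       : ∀ g → ∃[ σ ] (All (_∈Σ Sig) σ × g ≈ evalF σ)
      C2       : ∀ {a₁ a₂ a₃} → a₁ ∈Σ Sig → a₂ ∈Σ Sig → a₃ ∈Σ Sig →
                 ∃[ b ] ∃[ b' ] (b ∈Σ Sig × b' ∈Σ Sig × (a₁ ∙ a₂) ∙ a₃ ≈ b ∙ F b')
      C3       : ∀ {a₁ a₂ b} → a₁ ∈Σ Sig → a₂ ∈Σ Sig → a₁ ∙ a₂ ≈ F b → b ∈Σ Sig
      Σ₀⊆Σ     : ∀ {a} → a ∈Σ Sig0 → a ∈Σ Sig
      Σ₀-zero  : ε ∈Σ Sig0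
      Σ₀-rep   : ∀ {a} → a ∈Σ Sig → ∃[ b ] (b ∈Σ Sig0 × InImF (a - b))
      Σ₀-uniq  : ∀ {b b'} → b ∈Σ Sig0 → b' ∈Σ Sig0 → InImF (b - b') → b ≈ b'

  IF : Carrier → Set (c ⊔ ℓ)
  IF u = ∃[ n ] ∃[ a ] (a ∈Σ Sig × ¬ a ≈ ε × u ≈ Fpow n a)

  _⪯_ : Carrier → Carrier → Set (c ⊔ ℓ)
  x ⪯ y = (y ≈ ε) ⊎
          (∃[ i ] ∃[ j ] ∃[ a ] ∃[ b ] (a ∈Σ Sig × ¬ a ≈ ε × b ∈Σ Sig × ¬ b ≈ ε ×
             x ≈ Fpow i a × y ≈ Fpow j b × i ≤ j))

  _≺_ : Carrier → Carrier → Set (c ⊔ ℓ)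
  x ≺ y = x ⪯ y × ¬ (y ⪯ x)

  -- graph of V_F : "V_F(g) = v".
  -- g ≠ 0 and g = Σ_{i=m}^{n} F^i(b_i) = F^m [b_m … b_n]_F with b_m ∈ Σ₀∖{0}, b_i ∈ Σ.
  VF : Carrier → Carrier → Set (c ⊔ ℓ)
  VF g v = (g ≈ ε × v ≈ ε) ⊎
           (¬ g ≈ ε × ∃[ m ] ∃[ b ] ∃[ τ ] (b ∈Σ Sig0 × ¬ b ≈ ε × All (_∈Σ Sig) τ ×
              g ≈ Fpow m (evalF (b ∷ τ)) × v ≈ Fpow m b))

  -- R(g,u): g = Σ_{i=m}^{n} F^i(a_i) = F^m [a_m … a_n]_F with a_m ≠ 0,
  -- a_i ∈ Σ, a_n = a ∈ Σ∖{0}, u = F^n(a); the word is σ ++ [a], n = m + |σ|.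
  R : Carrier → Carrier → Set (c ⊔ ℓ)
  R g u = (g ≈ ε × u ≈ ε) ⊎
          (¬ g ≈ ε × ∃[ m ] ∃[ σ ] ∃[ a ] (All (_∈Σ Sig) σ × a ∈Σ Sig × ¬ a ≈ ε ×
             HeadNZ (σ ++ a ∷ []) ×
             g ≈ Fpow m (evalF (σ ++ a ∷ [])) × u ≈ Fpow (m + length σ) a))

  Good : Carrier → Carrier → Carrier → Set (c ⊔ ℓ)
  Good u g h = R h u × ∃[ v ] (VF (g - h) v × u ≺ v)

  εF : Carrier → Carrier → Set (c ⊔ ℓ)
  εF u g = IF u × (g ≈ u ⊎ ∃[ h ] Good u g h)

-- If R(h, u) with u = Fⁿ(a), then h = [p]_F + u for a word p ∈ Σ* of length n, and
-- u ≺ V_F(g − h) forces g − h ∈ Fⁿ⁺¹(Γ). Two such h, h' therefore give words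
-- p, p' of length ≤ K with [p]_F − [p']_F ∈ F^{K+1}(Γ). Subtracting digit by digit, (C2)
-- rewrites the running carry plus the two digits as e₀ + F(e₁) with e₀, e₁ ∈ Σ, and
-- Σ ∩ F(Γ) = {0} forces e₀ = 0; by induction on K the difference vanishes. Existence is
-- part of ε_F(u, g), with h = u when g = u.

module Submission where

open import Defs
open import Level using (_⊔_)
open import Data.Nat using (ℕ; zero; suc; _+_; _≤_; z≤n; s≤s; _≤?_)
open import Data.Nat.Properties using (≤-refl; ≤-total; ≰⇒>; m≤n⇒∃[o]m+o≡n; +-identityʳ)
open import Data.List using (List; []; _∷_; _++_; length; replicate)
open import Data.List.Properties using (length-++; length-replicate)
open import Data.List.Relation.Unary.All using (All; []; _∷_)
open import Data.List.Relation.Unary.All.Properties using (++⁺; replicate⁺)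
open import Data.Product using (∃-syntax; _×_; _,_; proj₁)
open import Data.Sum using (inj₁; inj₂)
open import Data.Empty using (⊥-elim)
open import Relation.Nullary using (¬_; yes; no)
open import Relation.Binary.PropositionalEquality as ≡ using (_≡_)
open import Algebra.Bundles using (AbelianGroup)
open import Algebra.Morphism.Structures using (module GroupMorphisms)

module AbelianGroupIdentities {c ℓ} (G : AbelianGroup c ℓ) where
  open AbelianGroup G
  open import Algebra.Properties.AbelianGroup G using (⁻¹-∙-comm; ⁻¹-anti-homo‿-)
  open import Algebra.Properties.CommutativeSemigroup commutativeSemigroup using (interchange)
  open import Relation.Binary.Reasoning.Setoid setoid

  -‿interchange : ∀ x y z w → (x ∙ y) - (z ∙ w) ≈ (x - z) ∙ (y - w)
  -‿interchange x y z w = begin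
    (x ∙ y) ∙ (z ∙ w) ⁻¹      ≈⟨ ∙-congˡ (sym (⁻¹-∙-comm z w)) ⟩
    (x ∙ y) ∙ (z ⁻¹ ∙ w ⁻¹)   ≈⟨ interchange x y (z ⁻¹) (w ⁻¹) ⟩
    (x - z) ∙ (y - w)         ∎

  -‿cancelʳ : ∀ x y z → (x ∙ z) - (y ∙ z) ≈ x - y
  -‿cancelʳ x y z = begin
    (x ∙ z) - (y ∙ z)    ≈⟨ -‿interchange x z y z ⟩
    (x - y) ∙ (z - z)    ≈⟨ ∙-congˡ (inverseʳ z) ⟩
    (x - y) ∙ ε          ≈⟨ identityʳ (x - y) ⟩
    x - y                ∎

  -‿cancelˡ : ∀ x y z → (x - z) - (x - y) ≈ y - z
  -‿cancelˡ x y z = begin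
    (x - z) ∙ (x - y) ⁻¹      ≈⟨ ∙-congˡ (⁻¹-anti-homo‿- x y) ⟩
    (x - z) ∙ (y - x)         ≈⟨ comm (x - z) (y - x) ⟩
    (y ∙ x ⁻¹) ∙ (x ∙ z ⁻¹)   ≈⟨ assoc y (x ⁻¹) (x - z) ⟩
    y ∙ (x ⁻¹ ∙ (x ∙ z ⁻¹))   ≈⟨ ∙-congˡ (sym (assoc (x ⁻¹) x (z ⁻¹))) ⟩
    y ∙ ((x ⁻¹ ∙ x) ∙ z ⁻¹)   ≈⟨ ∙-congˡ (∙-congʳ (inverseˡ x)) ⟩
    y ∙ (ε ∙ z ⁻¹)            ≈⟨ ∙-congˡ (identityˡ (z ⁻¹)) ⟩
    y - z                     ∎

module Words {c ℓ} (G : AbelianGroup c ℓ)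
             (F : AbelianGroup.Carrier G → AbelianGroup.Carrier G)
             (Sig Sig0 : List (AbelianGroup.Carrier G))
             (F-mono : GroupMorphisms.IsGroupMonomorphism
                         (AbelianGroup.rawGroup G) (AbelianGroup.rawGroup G) F) where
  open AbelianGroup G
  open Theory G F Sig Sig0
  open AbelianGroupIdentities G
  open import Relation.Binary.Reasoning.Setoid setoid
  module F = GroupMorphisms.IsGroupMonomorphism F-mono

  F-injective-ε : ∀ {x} → F x ≈ ε → x ≈ ε
  F-injective-ε Fx≈ε = F.injective (trans Fx≈ε (sym F.ε-homo))

  Fpow-cong : ∀ n {x y} → x ≈ y → Fpow n x ≈ Fpow n y
  Fpow-cong zero    x≈y = x≈y
  Fpow-cong (suc n) x≈y = F.⟦⟧-cong (Fpow-cong n x≈y)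

  Fpow-homo : ∀ n x y → Fpow n (x ∙ y) ≈ Fpow n x ∙ Fpow n y
  Fpow-homo zero    x y = refl
  Fpow-homo (suc n) x y = trans (F.⟦⟧-cong (Fpow-homo n x y)) (F.∙-homo _ _)

  Fpow-ε-homo : ∀ n → Fpow n ε ≈ ε
  Fpow-ε-homo zero    = refl
  Fpow-ε-homo (suc n) = trans (F.⟦⟧-cong (Fpow-ε-homo n)) F.ε-homo

  Fpow-⁻¹-homo : ∀ n x → Fpow n (x ⁻¹) ≈ Fpow n x ⁻¹
  Fpow-⁻¹-homo zero    x = refl
  Fpow-⁻¹-homo (suc n) x = trans (F.⟦⟧-cong (Fpow-⁻¹-homo n x)) (F.⁻¹-homo _)

  Fpow--homo : ∀ n x y → Fpow n (x - y) ≈ Fpow n x - Fpow n y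
  Fpow--homo n x y = trans (Fpow-homo n x (y ⁻¹)) (∙-congˡ (Fpow-⁻¹-homo n y))

  Fpow-+ : ∀ m n x → Fpow (m + n) x ≡ Fpow m (Fpow n x)
  Fpow-+ zero    n x = ≡.refl
  Fpow-+ (suc m) n x = ≡.cong F (Fpow-+ m n x)

  Fpow-injective-ε : ∀ n {x} → Fpow n x ≈ ε → x ≈ ε
  Fpow-injective-ε zero    x≈ε = x≈ε
  Fpow-injective-ε (suc n) Fx≈ε = Fpow-injective-ε n (F-injective-ε Fx≈ε)

  InImFpow : ℕ → Carrier → Set (c ⊔ ℓ)
  InImFpow n x = ∃[ y ] x ≈ Fpow n y

  InImFpow-resp : ∀ n {x y} → x ≈ y → InImFpow n x → InImFpow n y
  InImFpow-resp _ x≈y (z , x≈Fz) = z , trans (sym x≈y) x≈Fz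

  InImFpow-antitone : ∀ {m n x} → m ≤ n → InImFpow n x → InImFpow m x
  InImFpow-antitone {m} m≤n (y , x≈Fy) with m≤n⇒∃[o]m+o≡n m≤n
  ... | d , ≡.refl = Fpow d y , trans x≈Fy (reflexive (Fpow-+ m d y))

  InImFpow-- : ∀ n {x y} → InImFpow n x → InImFpow n y → InImFpow n (x - y)
  InImFpow-- n (x' , x≈) (y' , y≈) = x' - y' , trans (∙-cong x≈ (⁻¹-cong y≈)) (sym (Fpow--homo n x' y'))

  evalF-++ : ∀ p q → evalF (p ++ q) ≈ evalF p ∙ Fpow (length p) (evalF q)
  evalF-++ []      q = sym (identityˡ _)
  evalF-++ (a ∷ p) q = begin
    a ∙ F (evalF (p ++ q))                             ≈⟨ ∙-congˡ (F.⟦⟧-cong (evalF-++ p q)) ⟩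
    a ∙ F (evalF p ∙ Fpow (length p) (evalF q))        ≈⟨ ∙-congˡ (F.∙-homo _ _) ⟩
    a ∙ (F (evalF p) ∙ F (Fpow (length p) (evalF q)))  ≈⟨ sym (assoc _ _ _) ⟩
    a ∙ F (evalF p) ∙ F (Fpow (length p) (evalF q))    ∎

  evalF-replicate-ε : ∀ m p → evalF (replicate m ε ++ p) ≈ Fpow m (evalF p)
  evalF-replicate-ε zero    p = refl
  evalF-replicate-ε (suc m) p = trans (identityˡ _) (F.⟦⟧-cong (evalF-replicate-ε m p))

  evalF-[_] : ∀ a → evalF (a ∷ []) ≈ a
  evalF-[ a ] = trans (∙-congˡ F.ε-homo) (identityʳ a)

  -- The digits of a word read as an F-adic expansion; the empty word has digit 0.
  lowDigit : List Carrier → Carrier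
  lowDigit []      = ε
  lowDigit (a ∷ _) = a

  highDigits : List Carrier → List Carrier
  highDigits []      = []
  highDigits (_ ∷ p) = p

  evalF-digits : ∀ p → evalF p ≈ lowDigit p ∙ F (evalF (highDigits p))
  evalF-digits []      = sym (trans (identityˡ _) F.ε-homo)
  evalF-digits (a ∷ p) = refl

  length-highDigits : ∀ {n} p → length p ≤ suc n → length (highDigits p) ≤ n
  length-highDigits []      _           = z≤n
  length-highDigits (_ ∷ p) (s≤s |p|≤n) = |p|≤n

  carry-step : ∀ {b e₀ e₁} p q → b ∙ lowDigit p - lowDigit q ≈ e₀ ∙ F e₁ →
               b ∙ (evalF p - evalF q) ≈ e₀ ∙ F (e₁ ∙ (evalF (highDigits p) - evalF (highDigits q)))
  carry-step {b} {e₀} {e₁} p q carry = begin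
    b ∙ (evalF p - evalF q)                 ≈⟨ ∙-congˡ (∙-cong (evalF-digits p) (⁻¹-cong (evalF-digits q))) ⟩
    b ∙ ((d₀ ∙ F P) - (d₁ ∙ F Q))           ≈⟨ ∙-congˡ (-‿interchange d₀ (F P) d₁ (F Q)) ⟩
    b ∙ ((d₀ - d₁) ∙ (F P - F Q))           ≈⟨ sym (assoc b (d₀ - d₁) (F P - F Q)) ⟩
    b ∙ (d₀ - d₁) ∙ (F P - F Q)             ≈⟨ ∙-cong (sym (assoc b d₀ (d₁ ⁻¹))) (sym (Fpow--homo 1 P Q)) ⟩
    (b ∙ d₀ - d₁) ∙ F (P - Q)               ≈⟨ ∙-congʳ carry ⟩
    e₀ ∙ F e₁ ∙ F (P - Q)                   ≈⟨ assoc e₀ (F e₁) (F (P - Q)) ⟩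
    e₀ ∙ (F e₁ ∙ F (P - Q))                 ≈⟨ ∙-congˡ (sym (F.∙-homo e₁ (P - Q))) ⟩
    e₀ ∙ F (e₁ ∙ (P - Q))                   ∎
    where
    d₀ = lowDigit p
    d₁ = lowDigit q
    P = evalF (highDigits p)
    Q = evalF (highDigits q)

module Uniqueness {c ℓ} (G : AbelianGroup c ℓ)
                  (F : AbelianGroup.Carrier G → AbelianGroup.Carrier G)
                  (Sig Sig0 : List (AbelianGroup.Carrier G))
                  (H : Theory.Hyp G F Sig Sig0) where
  open AbelianGroup G
  open Theory G F Sig Sig0
  open Hyp H
  open AbelianGroupIdentities G
  open Words G F Sig Sig0 F-mono
  open import Algebra.Properties.AbelianGroup G using (x∙y⁻¹≈ε⇒x≈y; x≈y⇒x∙y⁻¹≈ε; //-rightDividesʳ)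
  open import Relation.Binary.Reasoning.Setoid setoid

  Word : List Carrier → Set (c ⊔ ℓ)
  Word = All (_∈Σ Sig)

  lowDigit∈Σ : ∀ {p} → Word p → lowDigit p ∈Σ Sig
  lowDigit∈Σ []      = Σ-zero
  lowDigit∈Σ (a ∷ _) = a

  highDigits-Word : ∀ {p} → Word p → Word (highDigits p)
  highDigits-Word []      = []
  highDigits-Word (_ ∷ p) = p

  Σ-∩F-∙F : ∀ {a y z} → a ∈Σ Sig → a ∙ F z ≈ F y → a ≈ ε
  Σ-∩F-∙F {a} {y} {z} a∈Σ a∙Fz≈Fy = Σ-∩F a∈Σ (y - z , (begin
    a                  ≈⟨ sym (//-rightDividesʳ (F z) a) ⟩
    a ∙ F z - F z      ≈⟨ ∙-congʳ a∙Fz≈Fy ⟩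
    F y - F z          ≈⟨ sym (Fpow--homo 1 y z) ⟩
    F (y - z)          ∎))

  carry-vanishes : ∀ N {p q b} → Word p → Word q → length p ≤ N → length q ≤ N →
                   b ∈Σ Sig → InImFpow (suc N) (b ∙ (evalF p - evalF q)) →
                   b ∙ (evalF p - evalF q) ≈ ε
  carry-vanishes zero {[]} {[]} {b} _ _ _ _ b∈Σ (x , b-0≈Fx) =
    trans b-0≈b (Σ-∩F b∈Σ (x , trans (sym b-0≈b) b-0≈Fx))
    where
    b-0≈b : b ∙ (ε - ε) ≈ b
    b-0≈b = trans (∙-congˡ (inverseʳ ε)) (identityʳ b)
  carry-vanishes (suc N) {p} {q} {b} p∈ q∈ |p|≤ |q|≤ b∈Σ (x , D≈Fy)
    with C2 b∈Σ (lowDigit∈Σ p∈) (Σ-sym (lowDigit∈Σ q∈))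
  ... | e₀ , e₁ , e₀∈Σ , e₁∈Σ , carry = begin
    b ∙ (evalF p - evalF q)   ≈⟨ D≈ ⟩
    e₀ ∙ F Z                  ≈⟨ ∙-cong e₀≈ε (F.⟦⟧-cong Z≈ε) ⟩
    ε ∙ F ε                   ≈⟨ identityˡ (F ε) ⟩
    F ε                       ≈⟨ F.ε-homo ⟩
    ε                         ∎
    where
    Z = e₁ ∙ (evalF (highDigits p) - evalF (highDigits q))
    D≈ : b ∙ (evalF p - evalF q) ≈ e₀ ∙ F Z
    D≈ = carry-step p q carry
    e₀∙FZ≈Fy : e₀ ∙ F Z ≈ F (Fpow (suc N) x)
    e₀∙FZ≈Fy = trans (sym D≈) D≈Fy
    e₀≈ε : e₀ ≈ ε
    e₀≈ε = Σ-∩F-∙F e₀∈Σ e₀∙FZ≈Fy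
    Z≈ε : Z ≈ ε
    Z≈ε = carry-vanishes N (highDigits-Word p∈) (highDigits-Word q∈)
            (length-highDigits p |p|≤) (length-highDigits q |q|≤) e₁∈Σ
            (x , F.injective (trans (sym (identityˡ (F Z))) (trans (∙-congʳ (sym e₀≈ε)) e₀∙FZ≈Fy)))

  residues-agree : ∀ K {u g h h' p p'} → Word p → Word p' → length p ≤ K → length p' ≤ K →
                   h ≈ evalF p ∙ u → h' ≈ evalF p' ∙ u →
                   InImFpow (suc K) (g - h) → InImFpow (suc K) (g - h') → h' ≈ h
  residues-agree K {u} {g} {h} {h'} {p} {p'} p∈ p'∈ |p|≤K |p'|≤K h≈ h'≈ g-h∈ g-h'∈ =
    sym (x∙y⁻¹≈ε⇒x≈y h h' (trans h-h'≈ (carry-vanishes K p∈ p'∈ |p|≤K |p'|≤K Σ-zero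
      (InImFpow-resp (suc K) h-h'≈ h-h'∈))))
    where
    h-h'∈ : InImFpow (suc K) (h - h')
    h-h'∈ = InImFpow-resp (suc K) (-‿cancelˡ g h h') (InImFpow-- (suc K) g-h'∈ g-h∈)
    h-h'≈ : h - h' ≈ ε ∙ (evalF p - evalF p')
    h-h'≈ = begin
      h - h'                          ≈⟨ ∙-cong h≈ (⁻¹-cong h'≈) ⟩
      (evalF p ∙ u) - (evalF p' ∙ u)  ≈⟨ -‿cancelʳ (evalF p) (evalF p') u ⟩
      evalF p - evalF p'              ≈⟨ sym (identityˡ _) ⟩
      ε ∙ (evalF p - evalF p')        ∎

  IF-at : ℕ → Carrier → Set (c ⊔ ℓ)
  IF-at n u = ∃[ a ] (a ∈Σ Sig × ¬ a ≈ ε × u ≈ Fpow n a)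

  IF-nonzero : ∀ {u} → IF u → ¬ u ≈ ε
  IF-nonzero (n , a , _ , a≉ε , u≈) u≈ε = a≉ε (Fpow-injective-ε n (trans (sym u≈) u≈ε))

  -- The leading m zeros of the paper's F^m [a_m … a_n]_F become explicit digits ε.
  R⇒digits : ∀ {h u} → ¬ u ≈ ε → R h u → ∃[ p ] (Word p × h ≈ evalF p ∙ u × IF-at (length p) u)
  R⇒digits u≉ε (inj₁ (_ , u≈ε)) = ⊥-elim (u≉ε u≈ε)
  R⇒digits {h} {u} _ (inj₂ (_ , m , σ , a , σ∈ , a∈Σ , a≉ε , _ , h≈ , u≈)) =
    replicate m ε ++ σ , ++⁺ (replicate⁺ m Σ-zero) σ∈ , h≈p+u ,
    a , a∈Σ , a≉ε , ≡.subst (λ k → u ≈ Fpow k a) (≡.sym |p|≡) u≈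
    where
    p = replicate m ε ++ σ
    |p|≡ : length p ≡ m + length σ
    |p|≡ = ≡.trans (length-++ (replicate m ε)) (≡.cong (_+ length σ) (length-replicate m))
    h≈p+u : h ≈ evalF p ∙ u
    h≈p+u = begin
      h                                                   ≈⟨ h≈ ⟩
      Fpow m (evalF (σ ++ a ∷ []))                        ≈⟨ Fpow-cong m (evalF-++ σ (a ∷ [])) ⟩
      Fpow m (evalF σ ∙ Fpow (length σ) (evalF (a ∷ [])))  ≈⟨ Fpow-homo m _ _ ⟩
      Fpow m (evalF σ) ∙ Fpow m (Fpow (length σ) (evalF (a ∷ [])))
        ≈⟨ ∙-cong (sym (evalF-replicate-ε m σ)) (Fpow-cong m (Fpow-cong (length σ) evalF-[ a ])) ⟩
      evalF p ∙ Fpow m (Fpow (length σ) a)                ≈⟨ ∙-congˡ (reflexive (≡.sym (Fpow-+ m (length σ) a))) ⟩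
      evalF p ∙ Fpow (m + length σ) a                     ≈⟨ ∙-congˡ (sym u≈) ⟩
      evalF p ∙ u                                         ∎

  good⇒residue : ∀ n {u g h} → IF-at n u → Good u g h → InImFpow (suc n) (g - h)
  good⇒residue n _ (_ , _ , inj₁ (g-h≈ε , _) , _) = ε , trans g-h≈ε (sym (Fpow-ε-homo (suc n)))
  good⇒residue n (a , a∈Σ , a≉ε , u≈)
               (_ , _ , inj₂ (_ , j , b , τ , b∈Σ₀ , b≉ε , _ , g-h≈ , v≈) , _ , v⋠u)
    with j ≤? n
  ... | yes j≤n = ⊥-elim (v⋠u (inj₂ (j , n , b , a , Σ₀⊆Σ b∈Σ₀ , b≉ε , a∈Σ , a≉ε , v≈ , u≈ , j≤n)))
  ... | no  j≰n = InImFpow-antitone (≰⇒> j≰n) (evalF (b ∷ τ) , g-h≈)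

  good-unique : ∀ {u g h h'} → IF u → Good u g h → Good u g h' → h' ≈ h
  good-unique u∈IF good good'
    with R⇒digits (IF-nonzero u∈IF) (proj₁ good) | R⇒digits (IF-nonzero u∈IF) (proj₁ good')
  ... | p , p∈ , h≈ , u∈ | p' , p'∈ , h'≈ , u∈' with ≤-total (length p) (length p')
  ... | inj₁ |p|≤|p'| = residues-agree _ p∈ p'∈ |p|≤|p'| ≤-refl h≈ h'≈
                          (good⇒residue (length p') u∈' good) (good⇒residue (length p') u∈' good')
  ... | inj₂ |p'|≤|p| = residues-agree _ p∈ p'∈ ≤-refl |p'|≤|p| h≈ h'≈
                          (good⇒residue (length p) u∈ good) (good⇒residue (length p) u∈ good')

  R-self : ∀ {u} → IF u → R u u
  R-self {u} u∈IF@(n , a , a∈Σ , a≉ε , u≈) =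
    inj₂ (IF-nonzero u∈IF , n , [] , a , [] , a∈Σ , a≉ε , a≉ε ,
          trans u≈ (Fpow-cong n (sym evalF-[ a ])) ,
          ≡.subst (λ k → u ≈ Fpow k a) (≡.sym (+-identityʳ n)) u≈)

  IF-≺-ε : ∀ {u} → IF u → u ≺ ε
  IF-≺-ε u∈IF = inj₁ refl , ε⋠u
    where
    ε⋠u : ¬ (ε ⪯ _)
    ε⋠u (inj₁ u≈ε)                                          = IF-nonzero u∈IF u≈ε
    ε⋠u (inj₂ (i , _ , a , _ , _ , a≉ε , _ , _ , ε≈Fa , _)) = a≉ε (Fpow-injective-ε i (sym ε≈Fa))

  good-self : ∀ {u g} → IF u → g ≈ u → Good u g u
  good-self u∈IF g≈u = R-self u∈IF , ε , inj₁ (x≈y⇒x∙y⁻¹≈ε g≈u , refl) , IF-≺-ε u∈IF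

lemma4p13 : ∀ {c ℓ} (G : AbelianGroup c ℓ)
              (F : AbelianGroup.Carrier G → AbelianGroup.Carrier G)
              (Sig Sig0 : List (AbelianGroup.Carrier G)) →
              Theory.Hyp G F Sig Sig0 →
              (g u : AbelianGroup.Carrier G) →
              Theory.IF G F Sig Sig0 u →
              Theory.εF G F Sig Sig0 u g →
              ∃[ h ] (Theory.Good G F Sig Sig0 u g h ×
                      (∀ h' → Theory.Good G F Sig Sig0 u g h' → AbelianGroup._≈_ G h' h))
lemma4p13 G F Sig Sig0 H g u u∈IF (_ , inj₁ g≈u) =
  u , good-self u∈IF g≈u , λ _ → good-unique u∈IF (good-self u∈IF g≈u)
  where open Uniqueness G F Sig Sig0 H
lemma4p13 G F Sig Sig0 H g u u∈IF (_ , inj₂ (h , good)) =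
  h , good , λ _ → good-unique u∈IF good
  where open Uniqueness G F Sig Sig0 H
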